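{- Let $S$ be a finite non-empty multiset of natural numbers. For a base $B$ with $|B|=k$ let $h_S(B)=|\{x\in S: x\ge \prod B\}|$ (counted with multiplicity). Then, in each of the following three cases, $\partial\mathit{cost}_S$ is a partial cost function for $\mathit{cost}_S$ and $h$ is an admissible heuristic for $\mathit{cost}_S$ and $\partial\mathit{cost}_S$: (1) $\mathit{cost}_S(B)=\mathit{sum\_digits}(S_{(B)})$, $\partial\mathit{cost}_S(B)=\mathit{cost}_S(B)-s_k$, $h=h_S$; (2) $\mathit{cost}_S(B)=\mathit{sum\_carry}(S_{(B)})$, $\partial\mathit{cost}_S(B)=\mathit{cost}_S(B)-s_k$, $h=h_S$; (3) $\mathit{cost}_S(B)=\mathit{num\_comp}(S_{(B)})$, $\partial\mathit{cost}_S(B)=\mathit{cost}_S(B)-f(s_k+c_k)$, and $h\equiv 0$.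
   Context: A base is a finite sequence $B=\langle r_0,\dots,r_{k-1}\rangle$ ($k=|B|\ge0$) of integers $r_i>1$, with weights $w_0=1$, $w_{i+1}=w_ir_i$, and $\prod B=r_0\cdots r_{k-1}$ ($=1$ if empty). Each natural number $v$ has a unique representation $v_{(B)}=\langle d_0,\dots,d_k\rangle$ with natural digits, $0\le d_i<r_i$ for $i<k$, $d_k$ unbounded, $v=\sum_i d_iw_i$. Write $S=\{v_1,\dots,v_n\}$ (with multiplicity) and let $a_{ij}$ be the $j$-th digit of $(v_i)_{(B)}$, $0\le j\le k$. Define $s_j=\sum_{i=1}^n a_{ij}$ for $0\le j\le k$ (so $s_k$ is the sum of the most significant digit column), $c_0=0$, $c_{j+1}=\lfloor (s_j+c_j)/r_j\rfloor$ for $0\le j<k$. Cost functions: $\mathit{sum\_digits}(S_{(B)})=\sum_{j=0}^k s_j$; $\mathit{sum\_carry}(S_{(B)})=\sum_{j=0}^k(s_j+c_j)$; $\mathit{num\_comp}(S_{(B)})=\sum_{j=0}^k f(s_j+c_j)$, where $f(0),\dots,f(8)$ are $0,0,1,3,5,9,12,16,19$ and for $n>8$, $f(n)=n\lceil\log_2 n\rceil(\lceil\log_2 n\rceil-1)/4+n-1$. Let $\mathit{Base}(S)$ be the set of bases $B$ with $\prod B\le\max(S)$. For bases $B,B'$, $B'$ extends $B$ (written $B'\succ B$) if $B$ is a prefix of $B'$ (possibly $B'=B$). A function $\partial\mathit{cost}_S$ is a partial cost function for $\mathit{cost}_S$ if for all $B\in\mathit{Base}(S)$ and all $B'\in\mathit{Base}(S)$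 with $B'\succ B$, $\mathit{cost}_S(B')\ge\partial\mathit{cost}_S(B)$. A function $h$ is an admissible heuristic for $\mathit{cost}_S$ and $\partial\mathit{cost}_S$ if for all $B,B'\in\mathit{Base}(S)$ with $B'\succ B$: $\mathit{cost}_S(B')\ge\partial\mathit{cost}_S(B')+h(B')\ge\partial\mathit{cost}_S(B)+h(B)$. -}

module Defs where

open import Data.Nat using (ℕ; zero; suc; _+_; _*_; _∸_; _≤_; _<_; _≤?_; _⊔_)
open import Data.Nat.DivMod using (_/_; _%_)
open import Data.Nat.Logarithm using (⌈log₂_⌉)
open import Data.List using (List; []; _∷_; _++_; map; length; filter; foldr)
open import Data.Nat.ListAction using (sum; product)
open import Data.List.Relation.Unary.All using (All)
open import Data.Product using (_×_; ∃)
open import Relation.Binary.PropositionalEquality using (_≡_)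

Base : Set
Base = List ℕ

IsBase : Base → Set
IsBase B = All (1 <_) B

-- quotient / remainder by a radix (radices are > 1 in every use; the
-- zero case is a dummy to make the function total)
quot : ℕ → ℕ → ℕ
quot zero    v = 0
quot (suc r) v = v / suc r

rem : ℕ → ℕ → ℕ
rem zero    v = v
rem (suc r) v = v % suc r

maxL : List ℕ → ℕ
maxL = foldr _⊔_ 0

-- last element (default 0 for empty list; never empty in use)
lastL : List ℕ → ℕ
lastL []           = 0
lastL (x ∷ [])     = x
lastL (x ∷ y ∷ xs) = lastL (y ∷ xs)

-- column sums s_0, ..., s_k of the digits of S in base B:
-- the j-th digit of v is rem r_j applied to (v div w_j); the last
-- (unbounded) digit is v div w_k.
colSums : Base → List ℕ → List ℕ
colSums []       S = sum S ∷ []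
colSums (r ∷ rs) S = sum (map (rem r) S) ∷ colSums rs (map (quot r) S)

-- the values s_j + c_j, j = 0..k, with carry c passed in (c_0 = 0)
carryTerms : ℕ → Base → List ℕ → List ℕ
carryTerms c []       S = sum S + c ∷ []
carryTerms c (r ∷ rs) S =
  let s = sum (map (rem r) S) in
  (s + c) ∷ carryTerms (quot r (s + c)) rs (map (quot r) S)

-- comparator-count function f
f : ℕ → ℕ
f 0 = 0
f 1 = 0
f 2 = 1
f 3 = 3
f 4 = 5
f 5 = 9
f 6 = 12
f 7 = 16
f 8 = 19
f n@(suc (suc (suc (suc (suc (suc (suc (suc (suc _))))))))) =
  (n * ⌈log₂ n ⌉ * (⌈log₂ n ⌉ ∸ 1)) / 4 + n ∸ 1

sumDigits : List ℕ → Base → ℕ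
sumDigits S B = sum (colSums B S)

sumCarry : List ℕ → Base → ℕ
sumCarry S B = sum (carryTerms 0 B S)

numComp : List ℕ → Base → ℕ
numComp S B = sum (map f (carryTerms 0 B S))

sk : List ℕ → Base → ℕ
sk S B = lastL (colSums B S)

skck : List ℕ → Base → ℕ
skck S B = lastL (carryTerms 0 B S)

hS : List ℕ → Base → ℕ
hS S B = length (filter (product B ≤?_) S)

InBase : List ℕ → Base → Set
InBase S B = IsBase B × product B ≤ maxL S

_≼_ : Base → Base → Set
B ≼ B' = ∃ λ E → B' ≡ B ++ E

IsPartialCost : List ℕ → (Base → ℕ) → (Base → ℕ) → Set
IsPartialCost S cost pcost =
  ∀ B B' → InBase S B → InBase S B' → B ≼ B' → pcost B ≤ cost B'

IsAdmissible : List ℕ → (Base → ℕ) → (Base → ℕ) → (Base → ℕ) → Set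
IsAdmissible S cost pcost h =
  ∀ B B' → InBase S B → InBase S B' → B ≼ B' →
    (pcost B' + h B' ≤ cost B') × (pcost B + h B ≤ pcost B' + h B')

module Submission where

-- Write a base B ++ E as the prefix B followed by the radices E.  The digit
-- columns of S in base B ++ E are the lower columns s_0 … s_{k-1} of S in
-- base B followed by the columns of the quotients ⌊x / ∏B⌋ (x ∈ S) in base E;
-- the carry terms s_j + c_j split in the same way, the carry into E being the
-- carry c_k out of B.  Hence each partial cost (the cost without its last
-- column) is a sum over the lower columns only, and it can only grow when the
-- base is extended.
--
-- For the heuristic h_S(B) = #{x ∈ S | ∏B ≤ x} we compare element-wise: an
-- x with ∏B ≤ x has a positive top digit ⌊x / ∏B⌋, so h_S(B) ≤ s_k; and if
-- moreover ∏(B ++ E) > x, then x's digits at positions k … k+|E|-1 are not all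
-- zero, so h_S(B) ≤ (digit sums of the quotients in base E) + h_S(B ++ E).

open import Defs
open import Data.Nat using (ℕ; zero; suc; _+_; _*_; _∸_; _≤_; _<_; _≤?_; z≤n; z<s)
open import Data.Nat.Properties
open import Data.Nat.DivMod using (_/_; m/n*n≤m; m*n/n≡m; /-monoˡ-≤; m<n⇒m%n≡m; m/n≡0⇒m<n)
open import Algebra.Properties.CommutativeSemigroup +-commutativeSemigroup
  using (interchange)
open import Data.List using (List; []; _∷_; _++_; map; length; filter)
open import Data.List.Properties using (map-∘; map-id; map-++)
open import Data.Nat.ListAction using (sum; product)
open import Data.Nat.ListAction.Properties using (sum-++)
open import Data.List.Relation.Unary.All using (_∷_)
open import Data.Product using (_×_; _,_; proj₁; proj₂)
open import Function using (_∘_)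
open import Relation.Nullary using (¬_; yes; no)
open import Relation.Unary using (Decidable)
open import Relation.Binary.PropositionalEquality
  using (_≡_; _≢_; refl; sym; trans; cong; cong₂; subst; module ≡-Reasoning)

-- Since heuristics are natural numbers, an admissible heuristic makes the
-- partial cost a lower bound for the cost of every extension.
admissible⇒partial : ∀ S (cost pcost h : Base → ℕ) →
  IsAdmissible S cost pcost h → IsPartialCost S cost pcost
admissible⇒partial S cost pcost h adm B B' inB inB' B≼B' = begin
  pcost B            ≤⟨ m≤m+n (pcost B) (h B) ⟩
  pcost B + h B      ≤⟨ proj₂ (adm B B' inB inB' B≼B') ⟩
  pcost B' + h B'    ≤⟨ proj₁ (adm B B' inB inB' B≼B') ⟩
  cost B'            ∎
  where open ≤-Reasoning

partial-and-admissible : ∀ S (cost pcost h : Base → ℕ) →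
  (∀ B → InBase S B → pcost B + h B ≤ cost B) →
  (∀ B E → InBase S B → pcost B + h B ≤ pcost (B ++ E) + h (B ++ E)) →
  IsPartialCost S cost pcost × IsAdmissible S cost pcost h
partial-and-admissible S cost pcost h bounded growing =
  admissible⇒partial S cost pcost h admissible , admissible
  where
  admissible : IsAdmissible S cost pcost h
  admissible B _ inB inB' (E , refl) = bounded (B ++ E) inB' , growing B E inB

lastL-snoc : ∀ xs y → lastL (xs ++ y ∷ []) ≡ y
lastL-snoc []            y = refl
lastL-snoc (x ∷ [])      y = refl
lastL-snoc (x ∷ x' ∷ xs) y = lastL-snoc (x' ∷ xs) y

sum-snoc : ∀ xs y → sum (xs ++ y ∷ []) ≡ sum xs + y
sum-snoc xs y = trans (sum-++ xs (y ∷ [])) (cong (sum xs +_) (+-identityʳ y))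

sum-map-++ : ∀ (g : ℕ → ℕ) xs ys → sum (map g (xs ++ ys)) ≡ sum (map g xs) + sum (map g ys)
sum-map-++ g xs ys = trans (cong sum (map-++ g xs ys)) (sum-++ (map g xs) (map g ys))

sum-map-+ : ∀ (g h : ℕ → ℕ) xs → sum (map (λ x → g x + h x) xs) ≡ sum (map g xs) + sum (map h xs)
sum-map-+ g h []       = refl
sum-map-+ g h (x ∷ xs) = trans (cong (g x + h x +_) (sum-map-+ g h xs))
                               (interchange (g x) (h x) (sum (map g xs)) (sum (map h xs)))

+-mono-≤-interchange : ∀ {i a j u v w} → i ≤ a + j → u ≤ v + w → i + u ≤ (a + v) + (j + w)
+-mono-≤-interchange {a = a} {j} {v = v} {w} i≤ u≤ =
  ≤-trans (+-mono-≤ i≤ u≤) (≤-reflexive (interchange a j v w))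

count-≤-sum : ∀ {P : ℕ → Set} (P? : Decidable P) (g : ℕ → ℕ) →
  (∀ x → P x → 0 < g x) → ∀ xs → length (filter P? xs) ≤ sum (map g xs)
count-≤-sum P? g positive []       = z≤n
count-≤-sum P? g positive (x ∷ xs) with P? x
... | yes px = +-mono-≤ (positive x px) (count-≤-sum P? g positive xs)
... | no _   = ≤-trans (count-≤-sum P? g positive xs) (m≤n+m _ (g x))

count-≤-sum+count : ∀ {P Q : ℕ → Set} (P? : Decidable P) (Q? : Decidable Q) (g : ℕ → ℕ) →
  (∀ x → P x → ¬ Q x → 0 < g x) →
  ∀ xs → length (filter P? xs) ≤ sum (map g xs) + length (filter Q? xs)
count-≤-sum+count P? Q? g positive []       = z≤n
count-≤-sum+count P? Q? g positive (x ∷ xs)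
  with P? x | Q? x | count-≤-sum+count P? Q? g positive xs
  -- x is counted [P x] times on the left and weighed g x + [Q x] on the right
... | yes _  | yes _  | ih = +-mono-≤-interchange {i = 1} {a = g x} {j = 1} (m≤n+m 1 (g x)) ih
... | yes px | no ¬qx | ih = +-mono-≤-interchange {i = 1} {a = g x} {j = 0}
                               (≤-trans (positive x px ¬qx) (m≤m+n (g x) 0)) ih
... | no _   | yes _  | ih = +-mono-≤-interchange {i = 0} {a = g x} {j = 1} z≤n ih
... | no _   | no _   | ih = +-mono-≤-interchange {i = 0} {a = g x} {j = 0} z≤n ih

column : ℕ → List ℕ → ℕ
column r S = sum (map (rem r) S)

-- quotient B x = ⌊x / ∏B⌋, the top digit of x in base B.
quotient : Base → ℕ → ℕ
quotient []       x = x
quotient (r ∷ rs) x = quotient rs (quot r x)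

quotients : Base → List ℕ → List ℕ
quotients []       S = S
quotients (r ∷ rs) S = quotients rs (map (quot r) S)

lowColumns : Base → List ℕ → List ℕ
lowColumns []       S = []
lowColumns (r ∷ rs) S = column r S ∷ lowColumns rs (map (quot r) S)

lowTerms : ℕ → Base → List ℕ → List ℕ
lowTerms c []       S = []
lowTerms c (r ∷ rs) S = (column r S + c) ∷ lowTerms (quot r (column r S + c)) rs (map (quot r) S)

carryOut : ℕ → Base → List ℕ → ℕ
carryOut c []       S = c
carryOut c (r ∷ rs) S = carryOut (quot r (column r S + c)) rs (map (quot r) S)

colSums-snoc : ∀ B S → colSums B S ≡ lowColumns B S ++ sum (quotients B S) ∷ []
colSums-snoc []       S = refl
colSums-snoc (r ∷ rs) S = cong (column r S ∷_) (colSums-snoc rs (map (quot r) S))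

carryTerms-snoc : ∀ c B S →
  carryTerms c B S ≡ lowTerms c B S ++ (sum (quotients B S) + carryOut c B S) ∷ []
carryTerms-snoc c []       S = refl
carryTerms-snoc c (r ∷ rs) S =
  cong (column r S + c ∷_) (carryTerms-snoc (quot r (column r S + c)) rs (map (quot r) S))

lowColumns-++ : ∀ B E S → lowColumns (B ++ E) S ≡ lowColumns B S ++ lowColumns E (quotients B S)
lowColumns-++ []       E S = refl
lowColumns-++ (r ∷ rs) E S = cong (column r S ∷_) (lowColumns-++ rs E (map (quot r) S))

lowTerms-++ : ∀ c B E S →
  lowTerms c (B ++ E) S ≡ lowTerms c B S ++ lowTerms (carryOut c B S) E (quotients B S)
lowTerms-++ c []       E S = refl
lowTerms-++ c (r ∷ rs) E S =
  cong (column r S + c ∷_) (lowTerms-++ (quot r (column r S + c)) rs E (map (quot r) S))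

carryOut-++ : ∀ c B E S → carryOut c (B ++ E) S ≡ carryOut (carryOut c B S) E (quotients B S)
carryOut-++ c []       E S = refl
carryOut-++ c (r ∷ rs) E S = carryOut-++ (quot r (column r S + c)) rs E (map (quot r) S)

quotients-map : ∀ B S → quotients B S ≡ map (quotient B) S
quotients-map []       S = sym (map-id S)
quotients-map (r ∷ rs) S = trans (quotients-map rs (map (quot r) S)) (sym (map-∘ S))

quotient-++ : ∀ B E x → quotient (B ++ E) x ≡ quotient E (quotient B x)
quotient-++ []       E x = refl
quotient-++ (r ∷ rs) E x = quotient-++ rs E (quot r x)

lowDigitSum : Base → ℕ → ℕ
lowDigitSum []       y = 0
lowDigitSum (r ∷ rs) y = rem r y + lowDigitSum rs (quot r y)

lowColumns-sum : ∀ E T → sum (lowColumns E T) ≡ sum (map (lowDigitSum E) T)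
lowColumns-sum []       []      = refl
lowColumns-sum []       (_ ∷ T) = lowColumns-sum [] T
lowColumns-sum (r ∷ rs) T = begin
  column r T + sum (lowColumns rs (map (quot r) T))
    ≡⟨ cong (column r T +_) (lowColumns-sum rs (map (quot r) T)) ⟩
  column r T + sum (map (lowDigitSum rs) (map (quot r) T))
    ≡⟨ cong (λ ys → column r T + sum ys) (sym (map-∘ T)) ⟩
  column r T + sum (map (lowDigitSum rs ∘ quot r) T)
    ≡⟨ sum-map-+ (rem r) (lowDigitSum rs ∘ quot r) T ⟨
  sum (map (lowDigitSum (r ∷ rs)) T) ∎
  where open ≡-Reasoning

carry-conservation : ∀ c E T → c + sum (lowColumns E T) ≤ sum (lowTerms c E T) + carryOut c E T
carry-conservation c []       T = ≤-reflexive (+-comm c 0)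
carry-conservation c (r ∷ rs) T = begin
  c + (column r T + X)   ≡⟨ +-assoc c (column r T) X ⟨
  c + column r T + X     ≡⟨ cong (_+ X) (+-comm c (column r T)) ⟩
  column r T + c + X     ≤⟨ +-monoʳ-≤ (column r T + c) (≤-trans (m≤n+m X c') ih) ⟩
  column r T + c + (I + K) ≡⟨ +-assoc (column r T + c) I K ⟨
  column r T + c + I + K ∎
  where
  open ≤-Reasoning
  c' = quot r (column r T + c)
  X  = sum (lowColumns rs (map (quot r) T))
  I  = sum (lowTerms c' rs (map (quot r) T))
  K  = carryOut c' rs (map (quot r) T)
  ih : c' + X ≤ I + K
  ih = carry-conservation c' rs (map (quot r) T)

quotient-positive : ∀ B → IsBase B → ∀ x → product B ≤ x → 0 < quotient B x
quotient-positive []           _          x 1≤x = 1≤x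
quotient-positive (suc r ∷ rs) (_ ∷ base) x ∏≤x = quotient-positive rs base (x / suc r) (begin
  product rs                   ≡⟨ m*n/n≡m (product rs) (suc r) ⟨
  product rs * suc r / suc r   ≤⟨ /-monoˡ-≤ (suc r) (subst (_≤ x) (*-comm (suc r) (product rs)) ∏≤x) ⟩
  x / suc r                    ∎)
  where open ≤-Reasoning

positive-quotient : ∀ B x → 0 < quotient B x → product B ≤ x
positive-quotient []           x q>0 = q>0
positive-quotient (zero ∷ rs)  x _   = z≤n
positive-quotient (suc r ∷ rs) x q>0 = begin
  suc r * product rs   ≤⟨ *-monoʳ-≤ (suc r) (positive-quotient rs (x / suc r) q>0) ⟩
  suc r * (x / suc r)  ≡⟨ *-comm (suc r) (x / suc r) ⟩
  x / suc r * suc r    ≤⟨ m/n*n≤m x (suc r) ⟩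
  x                    ∎
  where open ≤-Reasoning

rem-of-small : ∀ r y → quot r y ≡ 0 → rem r y ≡ y
rem-of-small zero    y _    = refl
rem-of-small (suc r) y q≡0 = m<n⇒m%n≡m (m/n≡0⇒m<n q≡0)

digitSum-positive : ∀ E y → 0 < y → 0 < lowDigitSum E y + quotient E y
digitSum-positive []       y y>0 = y>0
digitSum-positive (r ∷ rs) y y>0 with quot r y in q≡
... | zero  = ≤-trans (subst (0 <_) (sym (rem-of-small r y q≡)) y>0)
                      (≤-trans (m≤m+n (rem r y) _) (m≤m+n _ _))
... | suc q = ≤-trans (digitSum-positive rs (suc q) z<s)
                      (≤-trans (m≤n+m _ (rem r y)) (≤-reflexive (sym (+-assoc (rem r y) _ _))))

-- If ∏B ≤ x < ∏(B ++ E), the digits of x at the positions of E are not all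
-- zero: the top digit in base B is positive but the one in base B ++ E is not.
lowDigitSum-positive : ∀ B E → IsBase B → ∀ x →
  product B ≤ x → ¬ (product (B ++ E) ≤ x) → 0 < lowDigitSum E (quotient B x)
lowDigitSum-positive B E base x ∏B≤x ∏BE≰x =
  subst (0 <_) (trans (cong (lowDigitSum E y +_) top≡0) (+-identityʳ _))
        (digitSum-positive E y (quotient-positive B base x ∏B≤x))
  where
  y = quotient B x
  top≡0 : quotient E y ≡ 0
  top≡0 = n<1⇒n≡0 (≰⇒> λ top>0 →
    ∏BE≰x (positive-quotient (B ++ E) x (subst (0 <_) (sym (quotient-++ B E x)) top>0)))

heuristic≤top : ∀ S B → IsBase B → hS S B ≤ sum (quotients B S)
heuristic≤top S B base = begin
  hS S B                   ≤⟨ count-≤-sum (product B ≤?_) (quotient B) (quotient-positive B base) S ⟩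
  sum (map (quotient B) S) ≡⟨ cong sum (quotients-map B S) ⟨
  sum (quotients B S)      ∎
  where open ≤-Reasoning

heuristic-step : ∀ S B E → IsBase B →
  hS S B ≤ sum (lowColumns E (quotients B S)) + hS S (B ++ E)
heuristic-step S B E base = begin
  hS S B
    ≤⟨ count-≤-sum+count (product B ≤?_) (product (B ++ E) ≤?_) (lowDigitSum E ∘ quotient B)
                         (lowDigitSum-positive B E base) S ⟩
  sum (map (lowDigitSum E ∘ quotient B) S) + hS S (B ++ E)
    ≡⟨ cong (λ ys → sum ys + hS S (B ++ E)) (map-∘ S) ⟩
  sum (map (lowDigitSum E) (map (quotient B) S)) + hS S (B ++ E)
    ≡⟨ cong (λ ys → sum (map (lowDigitSum E) ys) + hS S (B ++ E)) (quotients-map B S) ⟨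
  sum (map (lowDigitSum E) (quotients B S)) + hS S (B ++ E)
    ≡⟨ cong (_+ hS S (B ++ E)) (lowColumns-sum E (quotients B S)) ⟨
  sum (lowColumns E (quotients B S)) + hS S (B ++ E) ∎
  where open ≤-Reasoning

sk-top : ∀ S B → sk S B ≡ sum (quotients B S)
sk-top S B = trans (cong lastL (colSums-snoc B S)) (lastL-snoc (lowColumns B S) _)

sumDigits-split : ∀ S B → sumDigits S B ≡ sum (lowColumns B S) + sum (quotients B S)
sumDigits-split S B = trans (cong sum (colSums-snoc B S)) (sum-snoc (lowColumns B S) _)

digitsPartial : List ℕ → Base → ℕ
digitsPartial S B = sumDigits S B ∸ sk S B

digitsPartial≡ : ∀ S B → digitsPartial S B ≡ sum (lowColumns B S)
digitsPartial≡ S B = trans (cong₂ _∸_ (sumDigits-split S B) (sk-top S B))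
                           (m+n∸n≡m (sum (lowColumns B S)) (sum (quotients B S)))

digits-case : ∀ S →
  IsPartialCost S (sumDigits S) (digitsPartial S) × IsAdmissible S (sumDigits S) (digitsPartial S) (hS S)
digits-case S = partial-and-admissible S (sumDigits S) (digitsPartial S) (hS S) bounded growing
  where
  open ≤-Reasoning
  bounded : ∀ B → InBase S B → digitsPartial S B + hS S B ≤ sumDigits S B
  bounded B (base , _) = begin
    digitsPartial S B + hS S B                   ≡⟨ cong (_+ hS S B) (digitsPartial≡ S B) ⟩
    sum (lowColumns B S) + hS S B                ≤⟨ +-monoʳ-≤ _ (heuristic≤top S B base) ⟩
    sum (lowColumns B S) + sum (quotients B S)   ≡⟨ sumDigits-split S B ⟨
    sumDigits S B                                ∎
  growing : ∀ B E → InBase S B →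
    digitsPartial S B + hS S B ≤ digitsPartial S (B ++ E) + hS S (B ++ E)
  growing B E (base , _) = begin
    digitsPartial S B + hS S B   ≡⟨ cong (_+ hS S B) (digitsPartial≡ S B) ⟩
    L + hS S B                   ≤⟨ +-monoʳ-≤ L (heuristic-step S B E base) ⟩
    L + (X + hS S (B ++ E))      ≡⟨ +-assoc L X _ ⟨
    L + X + hS S (B ++ E)        ≡⟨ cong (_+ hS S (B ++ E)) extended ⟨
    digitsPartial S (B ++ E) + hS S (B ++ E) ∎
    where
    L = sum (lowColumns B S)
    X = sum (lowColumns E (quotients B S))
    extended : digitsPartial S (B ++ E) ≡ L + X
    extended = trans (digitsPartial≡ S (B ++ E))
                     (trans (cong sum (lowColumns-++ B E S)) (sum-++ (lowColumns B S) _))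

-- sum_carry = Σ_{j<k} (s_j + c_j) + (s_k + c_k); its partial cost drops s_k
-- only, keeping the final carry c_k.
sumCarry-split : ∀ S B → sumCarry S B ≡ sum (lowTerms 0 B S) + (sum (quotients B S) + carryOut 0 B S)
sumCarry-split S B = trans (cong sum (carryTerms-snoc 0 B S)) (sum-snoc (lowTerms 0 B S) _)

carryPartial : List ℕ → Base → ℕ
carryPartial S B = sumCarry S B ∸ sk S B

carryPartial≡ : ∀ S B → carryPartial S B ≡ sum (lowTerms 0 B S) + carryOut 0 B S
carryPartial≡ S B = begin
  sumCarry S B ∸ sk S B             ≡⟨ cong₂ _∸_ (sumCarry-split S B) (sk-top S B) ⟩
  L + (t + c) ∸ t                   ≡⟨ cong (λ n → L + n ∸ t) (+-comm t c) ⟩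
  L + (c + t) ∸ t                   ≡⟨ cong (_∸ t) (+-assoc L c t) ⟨
  L + c + t ∸ t                     ≡⟨ m+n∸n≡m (L + c) t ⟩
  L + c                             ∎
  where
  open ≡-Reasoning
  L = sum (lowTerms 0 B S)
  t = sum (quotients B S)
  c = carryOut 0 B S

carry-case : ∀ S →
  IsPartialCost S (sumCarry S) (carryPartial S) × IsAdmissible S (sumCarry S) (carryPartial S) (hS S)
carry-case S = partial-and-admissible S (sumCarry S) (carryPartial S) (hS S) bounded growing
  where
  open ≤-Reasoning
  bounded : ∀ B → InBase S B → carryPartial S B + hS S B ≤ sumCarry S B
  bounded B (base , _) = begin
    carryPartial S B + hS S B   ≡⟨ cong (_+ hS S B) (carryPartial≡ S B) ⟩
    L + c + hS S B              ≡⟨ +-assoc L c _ ⟩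
    L + (c + hS S B)            ≤⟨ +-monoʳ-≤ L (+-monoʳ-≤ c (heuristic≤top S B base)) ⟩
    L + (c + t)                 ≡⟨ cong (L +_) (+-comm c t) ⟩
    L + (t + c)                 ≡⟨ sumCarry-split S B ⟨
    sumCarry S B                ∎
    where
    L = sum (lowTerms 0 B S)
    t = sum (quotients B S)
    c = carryOut 0 B S
  growing : ∀ B E → InBase S B →
    carryPartial S B + hS S B ≤ carryPartial S (B ++ E) + hS S (B ++ E)
  growing B E (base , _) = begin
    carryPartial S B + hS S B   ≡⟨ cong (_+ hS S B) (carryPartial≡ S B) ⟩
    L + c + hS S B              ≡⟨ +-assoc L c _ ⟩
    L + (c + hS S B)            ≤⟨ +-monoʳ-≤ L (+-monoʳ-≤ c (heuristic-step S B E base)) ⟩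
    L + (c + (X + h'))          ≡⟨ cong (L +_) (+-assoc c X h') ⟨
    L + (c + X + h')            ≤⟨ +-monoʳ-≤ L (+-monoˡ-≤ h' (carry-conservation c E T)) ⟩
    L + (I + K + h')            ≡⟨ +-assoc L (I + K) h' ⟨
    L + (I + K) + h'            ≡⟨ cong (_+ h') extended ⟨
    carryPartial S (B ++ E) + h' ∎
    where
    T  = quotients B S
    L  = sum (lowTerms 0 B S)
    c  = carryOut 0 B S
    X  = sum (lowColumns E T)
    I  = sum (lowTerms c E T)
    K  = carryOut c E T
    h' = hS S (B ++ E)
    extended : carryPartial S (B ++ E) ≡ L + (I + K)
    extended = begin-equality
      carryPartial S (B ++ E)                                  ≡⟨ carryPartial≡ S (B ++ E) ⟩
      sum (lowTerms 0 (B ++ E) S) + carryOut 0 (B ++ E) S      ≡⟨ cong₂ _+_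
                                                                    (cong sum (lowTerms-++ 0 B E S))
                                                                    (carryOut-++ 0 B E S) ⟩
      sum (lowTerms 0 B S ++ lowTerms c E T) + K               ≡⟨ cong (_+ K) (sum-++ (lowTerms 0 B S) _) ⟩
      L + I + K                                                ≡⟨ +-assoc L I K ⟩
      L + (I + K)                                              ∎

-- num_comp = Σ_{j<k} f(s_j + c_j) + f(s_k + c_k); its partial cost is the
-- first sum, which only gains summands under extension.
compPartial : List ℕ → Base → ℕ
compPartial S B = numComp S B ∸ f (skck S B)

compPartial≡ : ∀ S B → compPartial S B ≡ sum (map f (lowTerms 0 B S))
compPartial≡ S B = begin
  numComp S B ∸ f (skck S B)     ≡⟨ cong₂ (λ xs ys → sum (map f xs) ∸ f (lastL ys)) snoc snoc ⟩
  sum (map f (ts ++ t ∷ [])) ∸ f (lastL (ts ++ t ∷ []))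
                                 ≡⟨ cong₂ _∸_ (sum-map-++ f ts (t ∷ [])) (cong f (lastL-snoc ts t)) ⟩
  sum (map f ts) + (f t + 0) ∸ f t ≡⟨ cong (λ n → sum (map f ts) + n ∸ f t) (+-identityʳ (f t)) ⟩
  sum (map f ts) + f t ∸ f t     ≡⟨ m+n∸n≡m (sum (map f ts)) (f t) ⟩
  sum (map f ts)                 ∎
  where
  open ≡-Reasoning
  ts = lowTerms 0 B S
  t  = sum (quotients B S) + carryOut 0 B S
  snoc : carryTerms 0 B S ≡ ts ++ t ∷ []
  snoc = carryTerms-snoc 0 B S

comparators-case : ∀ S →
  IsPartialCost S (numComp S) (compPartial S) × IsAdmissible S (numComp S) (compPartial S) (λ _ → 0)
comparators-case S = partial-and-admissible S (numComp S) (compPartial S) (λ _ → 0) bounded growing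
  where
  open ≤-Reasoning
  bounded : ∀ B → InBase S B → compPartial S B + 0 ≤ numComp S B
  bounded B _ = begin
    compPartial S B + 0  ≡⟨ +-identityʳ _ ⟩
    compPartial S B      ≤⟨ m∸n≤m (numComp S B) (f (skck S B)) ⟩
    numComp S B          ∎
  growing : ∀ B E → InBase S B → compPartial S B + 0 ≤ compPartial S (B ++ E) + 0
  growing B E _ = +-monoˡ-≤ 0 (begin
    compPartial S B                      ≡⟨ compPartial≡ S B ⟩
    sum (map f ts)                       ≤⟨ m≤m+n _ _ ⟩
    sum (map f ts) + sum (map f ts')     ≡⟨ sum-map-++ f ts ts' ⟨
    sum (map f (ts ++ ts'))              ≡⟨ cong (sum ∘ map f) (lowTerms-++ 0 B E S) ⟨
    sum (map f (lowTerms 0 (B ++ E) S))  ≡⟨ compPartial≡ S (B ++ E) ⟨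
    compPartial S (B ++ E)               ∎)
    where
    ts  = lowTerms 0 B S
    ts' = lowTerms (carryOut 0 B S) E (quotients B S)

lemma4 : (S : List ℕ) → S ≢ [] →
    (IsPartialCost S (sumDigits S) (λ B → sumDigits S B ∸ sk S B)
      × IsAdmissible S (sumDigits S) (λ B → sumDigits S B ∸ sk S B) (hS S))
    × (IsPartialCost S (sumCarry S) (λ B → sumCarry S B ∸ sk S B)
      × IsAdmissible S (sumCarry S) (λ B → sumCarry S B ∸ sk S B) (hS S))
    × (IsPartialCost S (numComp S) (λ B → numComp S B ∸ f (skck S B))
      × IsAdmissible S (numComp S) (λ B → numComp S B ∸ f (skck S B)) (λ _ → 0))
lemma4 S _ = digits-case S , carry-case S , comparators-case S
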